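{- Let $G$ be a connected simple graph. Then $\sigma^-(G)=1$ if and only if $G$ has a cut-edge $e$ such that the two components of $G-e$ have orders differing by at most one.
   Context: For a graph $G$ with $N$ vertices and a bijection $f:V(G)\to\{1,\dots,N\}$, call an edge $uv$ negative under $f$ if $f(u)$ and $f(v)$ have opposite parity. The rna number $\sigma^-(G)$ is the minimum, over all such bijections $f$, of the number of negative edges under $f$. -}

module Defs where

open import Data.Nat using (ℕ; suc; _+_; _≤_; _<ᵇ_; _≡ᵇ_; _%_)
open import Data.Bool using (Bool; true; false; _∧_; _∨_; not; T)
open import Data.Fin using (Fin; toℕ)
open import Data.Fin.Subset using (Subset; _∈_; ∣_∣)
open import Data.Fin.Permutation using (Permutation′; _⟨$⟩ʳ_)
open import Data.List using (List; length; filterᵇ; cartesianProduct; allFin)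
open import Data.Product using (Σ; _×_; _,_; proj₁; proj₂; ∃)
open import Relation.Binary.PropositionalEquality using (_≡_)
open import Relation.Nullary using (¬_)
open import Function.Bundles using (_⇔_)

record Graph (n : ℕ) : Set where
  field
    adj   : Fin n → Fin n → Bool
    sym   : ∀ u v → adj u v ≡ adj v u
    irrefl : ∀ u → adj u u ≡ false
open Graph public

_=ᶠ_ : ∀ {n} → Fin n → Fin n → Bool
i =ᶠ j = toℕ i ≡ᵇ toℕ j

deleteEdge : ∀ {n} → Graph n → Fin n → Fin n → Graph n
adj (deleteEdge G u v) i j =
  adj G i j ∧ not (((i =ᶠ u) ∧ (j =ᶠ v)) ∨ ((i =ᶠ v) ∧ (j =ᶠ u)))
Graph.sym (deleteEdge G u v) i j = lemma
  where
  open import Data.Bool.Properties using (∧-comm; ∨-comm)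
  open import Relation.Binary.PropositionalEquality using (cong₂; cong)
  lemma : adj G i j ∧ not (((i =ᶠ u) ∧ (j =ᶠ v)) ∨ ((i =ᶠ v) ∧ (j =ᶠ u)))
        ≡ adj G j i ∧ not (((j =ᶠ u) ∧ (i =ᶠ v)) ∨ ((j =ᶠ v) ∧ (i =ᶠ u)))
  lemma = cong₂ _∧_ (Graph.sym G i j)
    (cong not (Relation.Binary.PropositionalEquality.trans
      (∨-comm ((i =ᶠ u) ∧ (j =ᶠ v)) ((i =ᶠ v) ∧ (j =ᶠ u)))
      (cong₂ _∨_ (∧-comm (i =ᶠ v) (j =ᶠ u)) (∧-comm (i =ᶠ u) (j =ᶠ v)))))
Graph.irrefl (deleteEdge G u v) i rewrite Graph.irrefl G i = Relation.Binary.PropositionalEquality.refl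

data Reach {n} (G : Graph n) : Fin n → Fin n → Set where
  here : ∀ {u} → Reach G u u
  step : ∀ {u v w} → T (adj G u v) → Reach G v w → Reach G u w

Connected : ∀ {n} → Graph n → Set
Connected G = ∀ u v → Reach G u v

IsCutEdge : ∀ {n} → Graph n → Fin n → Fin n → Set
IsCutEdge G u v = T (adj G u v) × ¬ Reach (deleteEdge G u v) u v

ComponentOrder : ∀ {n} → Graph n → Fin n → ℕ → Set
ComponentOrder {n} G u k =
  Σ (Subset n) λ S → (∀ w → (w ∈ S) ⇔ Reach G u w) × ∣ S ∣ ≡ k

edges : ∀ {n} → Graph n → List (Fin n × Fin n)
edges {n} G = filterᵇ (λ p → (toℕ (proj₁ p) <ᵇ toℕ (proj₂ p)) ∧ adj G (proj₁ p) (proj₂ p))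
                      (cartesianProduct (allFin n) (allFin n))

-- labelling f : V → {1..N} is a permutation of Fin n (vertex label = toℕ (f v) + 1;
-- shifting by 1 does not affect whether two labels have opposite parity)
oppParity : ℕ → ℕ → Bool
oppParity a b = not ((a % 2) ≡ᵇ (b % 2))

negEdges : ∀ {n} → Graph n → Permutation′ n → ℕ
negEdges G f = length (filterᵇ
  (λ p → oppParity (suc (toℕ (f ⟨$⟩ʳ proj₁ p))) (suc (toℕ (f ⟨$⟩ʳ proj₂ p))))
  (edges G))

RnaNumberIs : ∀ {n} → Graph n → ℕ → Set
RnaNumberIs G k = (∃ λ f → negEdges G f ≡ k) × (∀ f → k ≤ negEdges G f)

module Submission where

-- The parities of a labelling form a 2-colouring with classes of sizes ⌊N/2⌋ and ⌈N/2⌉ whose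
-- bichromatic edges are the negative edges; conversely, permuting labels realises every colouring
-- with these class sizes, up to swapping the colours. In a connected graph a walk between the two
-- classes crosses some bichromatic edge. If uv is the only one, G - uv has no path between the
-- classes, so uv is a cut-edge and the components of G - uv are the colour classes. Conversely,
-- colouring the two sides of a cut-edge differently leaves it as the only bichromatic edge, and
-- two orders summing to N differ by at most one exactly when they are ⌊N/2⌋ and ⌈N/2⌉.

open import Defs hiding (sym)
open import Data.Nat using (ℕ; zero; suc; _+_; _≤_; _<_; _<ᵇ_; _%_; z≤n; s≤s; ⌊_/2⌋; ⌈_/2⌉)
open import Data.Nat.Properties
  using (≡ᵇ⇒≡; ≡⇒≡ᵇ; <⇒<ᵇ; <ᵇ⇒<; <-cmp; <-asym; ≤-antisym; ≤-trans; m≤m+n; +-comm; +-suc;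
         +-cancelˡ-≡; ⌊n/2⌋≤⌈n/2⌉; n≡⌊n+n/2⌋; n≡⌈n+n/2⌉; +-0-commutativeMonoid)
open import Data.Bool using (Bool; true; false; _∧_; not; T)
open import Data.Bool.Properties using (_≟_; not-involutive; not-injective; ¬-not; ∧-zeroʳ; ∧-identityʳ; T-≡; T-∧)
open import Data.Fin using (Fin; zero; suc; toℕ)
open import Data.Fin.Properties using (toℕ-injective)
open import Data.Fin.Permutation using (Permutation′; _⟨$⟩ʳ_; _⟨$⟩ˡ_; lift₀; transpose; _∘ₚ_; inverseʳ)
  renaming (id to idₚ)
open import Data.List using (List; []; _∷_; length; filter; cartesianProduct; allFin)
open import Data.List.Properties using (filter-≐)
open import Data.List.Membership.Propositional using () renaming (_∈_ to _∈ₗ_)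
open import Data.List.Membership.Propositional.Properties using (∈-filter⁺; ∈-filter⁻; ∈-cartesianProduct⁺; ∈-allFin)
open import Data.List.Relation.Unary.Any using (here; there)
open import Data.List.Relation.Unary.All using (_∷_)
open import Data.List.Relation.Unary.AllPairs using (_∷_)
open import Data.List.Relation.Unary.Unique.Propositional using (Unique)
import Data.List.Relation.Unary.Unique.Propositional.Properties as Unique
open import Data.Fin.Subset using (Subset; _∈_; _⊆_; ∣_∣)
open import Data.Fin.Subset.Properties using (⊆-antisym)
open import Data.Vec using (tabulate; lookup)
open import Data.Vec.Properties using (lookup∘tabulate; []=⇒lookup; lookup⇒[]=)
import Data.Product
open import Data.Product using (Σ; ∃; ∃₂; _×_; _,_; proj₁; proj₂; swap)
open import Data.Product.Properties using (×-≡,≡←≡; ×-≡,≡→≡)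
import Data.Sum
open import Data.Sum using (_⊎_; inj₁; inj₂)
open import Data.Empty using (⊥; ⊥-elim)
open import Relation.Nullary using (¬_; ¬?; Dec; yes; no)
open import Relation.Nullary.Decidable using (T?; decidable-stable)
open import Function using (_∘_; _⇔_; mk⇔; Equivalence)
import Function.Properties.Equivalence as ⇔
open import Relation.Binary.Definitions using (tri<; tri≈; tri>)
open import Relation.Binary.PropositionalEquality using (_≡_; _≢_; _≗_; refl; sym; trans; cong; subst; subst₂)
open import Algebra.Properties.CommutativeMonoid.Sum +-0-commutativeMonoid using (sum; sum-cong-≗; sum-permute)

odd : ℕ → Bool
odd zero    = false
odd (suc n) = not (odd n)

fromBool : Bool → ℕ
fromBool false = 0
fromBool true  = 1

n%2≡fromBool-odd : ∀ n → n % 2 ≡ fromBool (odd n)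
n%2≡fromBool-odd zero          = refl
n%2≡fromBool-odd (suc zero)    = refl
n%2≡fromBool-odd (suc (suc n)) rewrite not-involutive (odd n) = n%2≡fromBool-odd n

-- Defs labels vertex w by toℕ (f w) + 1; the shift does not affect parity differences.
oppParity-suc⇔ : ∀ a b → T (oppParity (suc a) (suc b)) ⇔ (odd a ≢ odd b)
oppParity-suc⇔ a b rewrite n%2≡fromBool-odd (suc a) | n%2≡fromBool-odd (suc b) with odd a | odd b
... | true  | true  = mk⇔ (λ ()) (λ ne → ne refl)
... | false | false = mk⇔ (λ ()) (λ ne → ne refl)
... | true  | false = mk⇔ (λ _ ()) (λ _ → _)
... | false | true  = mk⇔ (λ _ ()) (λ _ → _)

count : ∀ {n} → (Fin n → Bool) → ℕ
count c = sum (fromBool ∘ c)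

module _ {n : ℕ} where

  count-cong : {c d : Fin n → Bool} → c ≗ d → count c ≡ count d
  count-cong c≗d = sum-cong-≗ (cong fromBool ∘ c≗d)

  count-permute : (c : Fin n → Bool) (π : Permutation′ n) → count (c ∘ (π ⟨$⟩ʳ_)) ≡ count c
  count-permute c π = sym (sum-permute (fromBool ∘ c) π)

count+count-not : ∀ {n} (c : Fin n → Bool) → count c + count (not ∘ c) ≡ n
count+count-not {zero}  c = refl
count+count-not {suc n} c with c zero
... | true  = cong suc (count+count-not (c ∘ suc))
... | false = trans (+-suc (count (c ∘ suc)) _) (cong suc (count+count-not (c ∘ suc)))

count-positive⇒∃ : ∀ {n} (c : Fin n → Bool) → 0 < count c → ∃ λ i → c i ≡ true
count-positive⇒∃ {suc n} c pos with c zero in c₀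
... | true  = zero , c₀
... | false with i , cᵢ ← count-positive⇒∃ (c ∘ suc) pos = suc i , cᵢ

count-odd  : ∀ n → count {n} (odd ∘ toℕ) ≡ ⌊ n /2⌋
count-even : ∀ n → count {n} (not ∘ odd ∘ toℕ) ≡ ⌈ n /2⌉
count-odd zero     = refl
count-odd (suc n)  = count-even n
count-even zero    = refl
count-even (suc n) =
  cong suc (trans (count-cong {n} {not ∘ not ∘ odd ∘ toℕ} (not-involutive ∘ odd ∘ toℕ)) (count-odd n))

∣tabulate∣≡count : ∀ {n} (c : Fin n → Bool) → ∣ tabulate c ∣ ≡ count c
∣tabulate∣≡count {zero}  c = refl
∣tabulate∣≡count {suc n} c with c zero
... | true  = cong suc (∣tabulate∣≡count (c ∘ suc))
... | false = ∣tabulate∣≡count (c ∘ suc)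

∈-tabulate⇔ : ∀ {n} (c : Fin n → Bool) w → w ∈ tabulate c ⇔ c w ≡ true
∈-tabulate⇔ c w = mk⇔ (λ w∈ → trans (sym (lookup∘tabulate c w)) ([]=⇒lookup w∈))
                     (λ cw → lookup⇒[]= w (tabulate c) (trans (lookup∘tabulate c w) cw))

∈⇔lookup : ∀ {n} (S : Subset n) w → w ∈ S ⇔ lookup S w ≡ true
∈⇔lookup S w = mk⇔ []=⇒lookup (lookup⇒[]= w S)

count-not≡ : ∀ {n} (c d : Fin n → Bool) → count c ≡ count d → count (not ∘ c) ≡ count (not ∘ d)
count-not≡ c d c≡d = +-cancelˡ-≡ (count c) _ _
  (trans (count+count-not c) (sym (trans (cong (_+ _) c≡d) (count+count-not d))))

count-head-positive : ∀ {n} (c : Fin (suc n) → Bool) → c zero ≡ true → 0 < count c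
count-head-positive c c₀ = subst (λ b → 0 < fromBool b + count (c ∘ suc)) (sym c₀) (s≤s z≤n)

count-tail≡ : ∀ {n} (c d : Fin (suc n) → Bool) → count c ≡ count d → c zero ≡ d zero →
              count (c ∘ suc) ≡ count (d ∘ suc)
count-tail≡ c d c≡d c₀≡d₀ = +-cancelˡ-≡ (fromBool (c zero)) _ _
  (trans c≡d (cong (λ b → fromBool b + count (d ∘ suc)) (sym c₀≡d₀)))

count≡⇒∃ : ∀ {n} (c d : Fin (suc n) → Bool) → count c ≡ count d → ∃ λ j → d j ≡ c zero
count≡⇒∃ c d c≡d with c zero ≟ true
... | yes c₀ = Data.Product.map₂ (λ dⱼ → trans dⱼ (sym c₀))
                 (count-positive⇒∃ d (subst (0 <_) c≡d (count-head-positive c c₀)))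
... | no ¬c₀ = Data.Product.map₂ (λ ¬dⱼ → trans (not-injective ¬dⱼ) (sym (¬-not ¬c₀)))
                 (count-positive⇒∃ (not ∘ d)
                   (subst (0 <_) (count-not≡ c d c≡d)
                     (count-head-positive (not ∘ c) (cong not (¬-not ¬c₀)))))

-- Put a vertex of d's value at position zero by a transposition, then recurse on the rest.
count≡⇒permutation : ∀ {n} (c d : Fin n → Bool) → count c ≡ count d →
                     Σ (Permutation′ n) λ π → ∀ w → d (π ⟨$⟩ʳ w) ≡ c w
count≡⇒permutation {zero}  c d _ = idₚ , λ ()
count≡⇒permutation {suc n} c d c≡d
  with j , dⱼ ← count≡⇒∃ c d c≡d
  with π , dπ ← count≡⇒permutation (c ∘ suc) (d ∘ (transpose zero j ⟨$⟩ʳ_) ∘ suc)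
                  (count-tail≡ c (d ∘ (transpose zero j ⟨$⟩ʳ_))
                     (trans c≡d (sym (count-permute d (transpose zero j)))) (sym dⱼ))
  = lift₀ π ∘ₚ transpose zero j , λ { zero → dⱼ ; (suc w) → dπ w }

length-positive : ∀ {A : Set} {x : A} {xs} → x ∈ₗ xs → 0 < length xs
length-positive (here _)  = s≤s z≤n
length-positive (there _) = s≤s z≤n

unique⇒length≡1 : ∀ {A : Set} {x : A} {xs} → Unique xs → x ∈ₗ xs → (∀ {y} → y ∈ₗ xs → y ≡ x) → length xs ≡ 1
unique⇒length≡1 {xs = _ ∷ []}              _                 _ _     = refl
unique⇒length≡1 {xs = _ ∷ _ ∷ _} ((z≢w ∷ _) ∷ _) _ all≡x =
  ⊥-elim (z≢w (trans (all≡x (here refl)) (sym (all≡x (there (here refl))))))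

Balanced : ℕ → ℕ → Set
Balanced a b = a ≤ b + 1 × b ≤ a + 1

⌈n/2⌉≤⌊n/2⌋+1 : ∀ n → ⌈ n /2⌉ ≤ ⌊ n /2⌋ + 1
⌈n/2⌉≤⌊n/2⌋+1 zero          = z≤n
⌈n/2⌉≤⌊n/2⌋+1 (suc zero)    = s≤s z≤n
⌈n/2⌉≤⌊n/2⌋+1 (suc (suc n)) = s≤s (⌈n/2⌉≤⌊n/2⌋+1 n)

balanced-halves : ∀ n → Balanced ⌊ n /2⌋ ⌈ n /2⌉
balanced-halves n = ≤-trans (⌊n/2⌋≤⌈n/2⌉ n) (m≤m+n _ 1) , ⌈n/2⌉≤⌊n/2⌋+1 n

balanced⇒half : ∀ {a b} → Balanced a b → a ≡ ⌊ (a + b) /2⌋ ⊎ a ≡ ⌈ (a + b) /2⌉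
balanced⇒half {a} {b} (a≤b+1 , b≤a+1) with <-cmp a b
... | tri≈ _ refl _ = inj₁ (n≡⌊n+n/2⌋ a)
... | tri< a<b _ _ with refl ← ≤-antisym (subst (b ≤_) (+-comm a 1) b≤a+1) a<b
  = inj₁ (trans (n≡⌈n+n/2⌉ a) (cong ⌊_/2⌋ (sym (+-suc a a))))
... | tri> _ _ b<a with refl ← ≤-antisym (subst (a ≤_) (+-comm b 1) a≤b+1) b<a
  = inj₂ (cong suc (n≡⌊n+n/2⌋ b))

module _ {n} {H : Graph n} where

  reach-snoc : ∀ {u v w} → Reach H u v → T (adj H v w) → Reach H u w
  reach-snoc here       vw = step vw here
  reach-snoc (step e r) vw = step e (reach-snoc r vw)

  reach-sym : ∀ {u v} → Reach H u v → Reach H v u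
  reach-sym here                 = here
  reach-sym (step {u} {v} uv r) = reach-snoc (reach-sym r) (subst T (Graph.sym H u v) uv)

  reach-respects : {c : Fin n → Bool} → (∀ {x y} → T (adj H x y) → c x ≡ c y) →
                   ∀ {x y} → Reach H x y → c x ≡ c y
  reach-respects resp here       = refl
  reach-respects resp (step e r) = trans (resp e) (reach-respects resp r)

  reach-crossing : (c : Fin n → Bool) → ∀ {x y} → Reach H x y → c x ≢ c y →
                   ∃₂ λ s t → T (adj H s t) × c s ≢ c t
  reach-crossing c here cx≢cy = ⊥-elim (cx≢cy refl)
  reach-crossing c (step {x} {x′} e r) cx≢cy with c x ≟ c x′
  ... | yes cx≡cx′ = reach-crossing c r (cx≢cy ∘ trans cx≡cx′)
  ... | no  cx≢cx′ = x , x′ , e , cx≢cx′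

  component-respects-adj : {c : Fin n → Bool} {p : Fin n} → (∀ w → Reach H p w ⇔ c w ≡ true) →
                           ∀ {x y} → T (adj H x y) → c x ≡ c y
  component-respects-adj {c} {p} comp {x} {y} xy with c x in cx | c y in cy
  ... | true  | true  = refl
  ... | false | false = refl
  ... | true  | false = trans (sym (Equivalence.to (comp y) (reach-snoc (Equivalence.from (comp x) cx) xy))) cy
  ... | false | true  = trans (sym cx) (Equivalence.to (comp x)
                          (reach-snoc (Equivalence.from (comp y) cy) (subst T (Graph.sym H x y) xy)))

  colourClass⇔component : {c : Fin n → Bool} {p q : Fin n} → (∀ {x y} → T (adj H x y) → c x ≡ c y) →
                          (∀ w → Reach H p w ⊎ Reach H q w) → c p ≡ true → c q ≡ false →
                          ∀ w → Reach H p w ⇔ c w ≡ true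
  colourClass⇔component {c} {p} resp sides cp cq w = mk⇔ (λ r → trans (sym (reach-respects resp r)) cp) from
    where
    from : c w ≡ true → Reach H p w
    from cw with sides w
    ... | inj₁ r = r
    ... | inj₂ r with () ← trans (sym cq) (trans (reach-respects resp r) cw)

  componentOrder-count : {c : Fin n → Bool} {p : Fin n} → (∀ w → Reach H p w ⇔ c w ≡ true) →
                         ComponentOrder H p (count c)
  componentOrder-count {c} comp =
    tabulate c , (λ w → mk⇔ (Equivalence.from (comp w) ∘ Equivalence.to (∈-tabulate⇔ c w))
                            (Equivalence.from (∈-tabulate⇔ c w) ∘ Equivalence.to (comp w))) ,
    ∣tabulate∣≡count c

  componentOrder-unique : ∀ {p a b} → ComponentOrder H p a → ComponentOrder H p b → a ≡ b
  componentOrder-unique (S , S⇔ , ∣S∣≡a) (S′ , S′⇔ , ∣S′∣≡b) =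
    trans (sym ∣S∣≡a) (trans (cong ∣_∣ (⊆-antisym S⊆S′ S′⊆S)) ∣S′∣≡b)
    where
    S⊆S′ : S ⊆ S′
    S⊆S′ {w} = Equivalence.from (S′⇔ w) ∘ Equivalence.to (S⇔ w)
    S′⊆S : S′ ⊆ S
    S′⊆S {w} = Equivalence.from (S⇔ w) ∘ Equivalence.to (S′⇔ w)

=ᶠ⇒≡ : ∀ {n} {x y : Fin n} → T (x =ᶠ y) → x ≡ y
=ᶠ⇒≡ {x = x} {y} x=y = toℕ-injective (≡ᵇ⇒≡ (toℕ x) (toℕ y) x=y)

=ᶠ-refl : ∀ {n} (x : Fin n) → (x =ᶠ x) ≡ true
=ᶠ-refl x = Equivalence.to T-≡ (≡⇒≡ᵇ (toℕ x) (toℕ x) refl)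

module _ {n} (G : Graph n) (u v : Fin n) where

  private
    D : Graph n
    D = deleteEdge G u v

  adj-deleteEdge⊆ : ∀ {x y} → T (adj D x y) → T (adj G x y)
  adj-deleteEdge⊆ = proj₁ ∘ Equivalence.to T-∧

  adj-deleteEdge⁻ : ∀ {x y} → T (adj G x y) →
                    (x ≡ u × y ≡ v) ⊎ (x ≡ v × y ≡ u) ⊎ T (adj D x y)
  adj-deleteEdge⁻ {x} {y} xy with (x =ᶠ u) ∧ (y =ᶠ v) in xy=uv | (x =ᶠ v) ∧ (y =ᶠ u) in xy=vu
  ... | true  | _     = inj₁ (Data.Product.map =ᶠ⇒≡ =ᶠ⇒≡ (Equivalence.to T-∧ (Equivalence.from T-≡ xy=uv)))
  ... | false | true  = inj₂ (inj₁ (Data.Product.map =ᶠ⇒≡ =ᶠ⇒≡ (Equivalence.to T-∧ (Equivalence.from T-≡ xy=vu))))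
  ... | false | false = inj₂ (inj₂ (subst T (sym (∧-identityʳ _)) xy))

  deleteEdge-removes : ¬ T (adj D u v)
  deleteEdge-removes rewrite =ᶠ-refl u | =ᶠ-refl v | ∧-zeroʳ (adj G u v) = λ ()

  deleteEdge-removes′ : ¬ T (adj D v u)
  deleteEdge-removes′ = deleteEdge-removes ∘ subst T (Graph.sym D v u)

  -- Walk towards u in G and stop at the first endpoint of uv that is met.
  reach-deleteEdge : ∀ {w} → Reach G w u → Reach D w u ⊎ Reach D w v
  reach-deleteEdge here = inj₁ here
  reach-deleteEdge (step xy r) with adj-deleteEdge⁻ xy
  ... | inj₁ (refl , _)        = inj₁ here
  ... | inj₂ (inj₁ (refl , _)) = inj₂ here
  ... | inj₂ (inj₂ xy′)        = Data.Sum.map (step xy′) (step xy′) (reach-deleteEdge r)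

  deleteEdge-sides : Connected G → ∀ w → Reach D u w ⊎ Reach D v w
  deleteEdge-sides connected w = Data.Sum.map reach-sym reach-sym (reach-deleteEdge (connected w u))

module _ {n} (G : Graph n) where

  bichromaticEdges : (Fin n → Bool) → List (Fin n × Fin n)
  bichromaticEdges c = filter (λ e → ¬? (c (proj₁ e) ≟ c (proj₂ e))) (edges G)

  #bichromatic : (Fin n → Bool) → ℕ
  #bichromatic c = length (bichromaticEdges c)

  private
    isEdge : Fin n × Fin n → Bool
    isEdge (x , y) = (toℕ x <ᵇ toℕ y) ∧ adj G x y

  ∈-edges⁺ : ∀ {x y} → toℕ x < toℕ y → T (adj G x y) → (x , y) ∈ₗ edges G
  ∈-edges⁺ {x} {y} x<y xy = ∈-filter⁺ (T? ∘ isEdge) (∈-cartesianProduct⁺ (∈-allFin x) (∈-allFin y))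
                                      (Equivalence.from T-∧ (<⇒<ᵇ x<y , xy))

  ∈-edges⁻ : ∀ {x y} → (x , y) ∈ₗ edges G → toℕ x < toℕ y × T (adj G x y)
  ∈-edges⁻ {x} {y} xy∈ = Data.Product.map₁ (<ᵇ⇒< (toℕ x) (toℕ y))
    (Equivalence.to T-∧ (proj₂ (∈-filter⁻ (T? ∘ isEdge) {xs = cartesianProduct (allFin n) (allFin n)} xy∈)))

  edge-oriented : ∀ {x y} → T (adj G x y) → (x , y) ∈ₗ edges G ⊎ (y , x) ∈ₗ edges G
  edge-oriented {x} {y} xy with <-cmp (toℕ x) (toℕ y)
  ... | tri< x<y _ _ = inj₁ (∈-edges⁺ x<y xy)
  ... | tri≈ _ x≡y _ with refl ← toℕ-injective x≡y = ⊥-elim (subst T (irrefl G x) xy)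
  ... | tri> _ _ y<x = inj₂ (∈-edges⁺ y<x (subst T (Graph.sym G x y) xy))

  module _ {c : Fin n → Bool} where

    private
      bichromatic? : ∀ (e : Fin n × Fin n) → Dec (c (proj₁ e) ≢ c (proj₂ e))
      bichromatic? e = ¬? (c (proj₁ e) ≟ c (proj₂ e))

    ∈-bichromaticEdges⁺ : ∀ {x y} → T (adj G x y) → c x ≢ c y →
                          (x , y) ∈ₗ bichromaticEdges c ⊎ (y , x) ∈ₗ bichromaticEdges c
    ∈-bichromaticEdges⁺ xy cx≢cy =
      Data.Sum.map (λ xy∈ → ∈-filter⁺ bichromatic? xy∈ cx≢cy)
                   (λ yx∈ → ∈-filter⁺ bichromatic? yx∈ (cx≢cy ∘ sym))
                   (edge-oriented xy)

    ∈-bichromaticEdges⁻ : ∀ {x y} → (x , y) ∈ₗ bichromaticEdges c →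
                          toℕ x < toℕ y × T (adj G x y) × c x ≢ c y
    ∈-bichromaticEdges⁻ xy∈ with xy∈edges , cx≢cy ← ∈-filter⁻ bichromatic? {xs = edges G} xy∈ =
      Data.Product.map₂ (_, cx≢cy) (∈-edges⁻ xy∈edges)

    bichromaticEdges-unique : Unique (bichromaticEdges c)
    bichromaticEdges-unique = Unique.filter⁺ bichromatic?
      (Unique.filter⁺ (T? ∘ isEdge) (Unique.cartesianProduct⁺ (Unique.allFin⁺ n) (Unique.allFin⁺ n)))

    #bichromatic-positive : ∀ {x y} → T (adj G x y) → c x ≢ c y → 0 < #bichromatic c
    #bichromatic-positive xy cx≢cy = Data.Sum.[ length-positive , length-positive ] (∈-bichromaticEdges⁺ xy cx≢cy)

  #bichromatic-cong : {c d : Fin n → Bool} → (∀ x y → c x ≡ c y ⇔ d x ≡ d y) → #bichromatic c ≡ #bichromatic d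
  #bichromatic-cong {c} {d} c⇔d = cong length (filter-≐
    (λ e → ¬? (c (proj₁ e) ≟ c (proj₂ e))) (λ e → ¬? (d (proj₁ e) ≟ d (proj₂ e)))
    ((λ {e} cx≢cy → cx≢cy ∘ Equivalence.from (c⇔d (proj₁ e) (proj₂ e))) ,
     (λ {e} dx≢dy → dx≢dy ∘ Equivalence.to (c⇔d (proj₁ e) (proj₂ e))))
    (edges G))

  #bichromatic-≗ : {c d : Fin n → Bool} → c ≗ d → #bichromatic c ≡ #bichromatic d
  #bichromatic-≗ c≗d = #bichromatic-cong λ x y →
    mk⇔ (λ cx≡cy → trans (sym (c≗d x)) (trans cx≡cy (c≗d y))) (λ dx≡dy → trans (c≗d x) (trans dx≡dy (sym (c≗d y))))

  #bichromatic-not : (c : Fin n → Bool) → #bichromatic (not ∘ c) ≡ #bichromatic c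
  #bichromatic-not c = #bichromatic-cong λ x y → mk⇔ not-injective (cong not)

  SoleBichromaticEdge : (Fin n → Bool) → Fin n → Fin n → Set
  SoleBichromaticEdge c u v = T (adj G u v) × c u ≢ c v ×
    (∀ {x y} → T (adj G x y) → c x ≢ c y → (x ≡ u × y ≡ v) ⊎ (x ≡ v × y ≡ u))

  #bichromatic≡1⇒sole : {c : Fin n → Bool} → #bichromatic c ≡ 1 → ∃₂ (SoleBichromaticEdge c)
  #bichromatic≡1⇒sole {c} #≡1 with bichromaticEdges c in B≡ | #≡1
  ... | (u , v) ∷ [] | _ = u , v , uv , cu≢cv , sole
    where
    uv∈B : (u , v) ∈ₗ bichromaticEdges c
    uv∈B = subst ((u , v) ∈ₗ_) (sym B≡) (here refl)
    uv : T (adj G u v)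
    uv = proj₁ (proj₂ (∈-bichromaticEdges⁻ uv∈B))
    cu≢cv : c u ≢ c v
    cu≢cv = proj₂ (proj₂ (∈-bichromaticEdges⁻ uv∈B))
    only : ∀ {e} → e ∈ₗ bichromaticEdges c → e ≡ (u , v)
    only e∈ with here e≡uv ← subst (_ ∈ₗ_) B≡ e∈ = e≡uv
    sole : ∀ {x y} → T (adj G x y) → c x ≢ c y → (x ≡ u × y ≡ v) ⊎ (x ≡ v × y ≡ u)
    sole xy cx≢cy = Data.Sum.map (×-≡,≡←≡ ∘ only) (swap ∘ ×-≡,≡←≡ ∘ only) (∈-bichromaticEdges⁺ xy cx≢cy)

  sole⇒#bichromatic≡1 : {c : Fin n → Bool} {u v : Fin n} → SoleBichromaticEdge c u v → #bichromatic c ≡ 1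
  sole⇒#bichromatic≡1 {c} {u} {v} (uv , cu≢cv , sole) =
    Data.Sum.[ length≡1 , length≡1 ] (∈-bichromaticEdges⁺ uv cu≢cv)
    where
    B : List (Fin n × Fin n)
    B = bichromaticEdges c
    endpoints : ∀ {e} → e ∈ₗ B → e ≡ (u , v) ⊎ e ≡ (v , u)
    endpoints e∈ with _ , xy , cx≢cy ← ∈-bichromaticEdges⁻ e∈ = Data.Sum.map ×-≡,≡→≡ ×-≡,≡→≡ (sole xy cx≢cy)
    not-both : ∀ {x y} → (x , y) ∈ₗ B → (y , x) ∈ₗ B → ⊥
    not-both xy∈ yx∈ = <-asym (proj₁ (∈-bichromaticEdges⁻ xy∈)) (proj₁ (∈-bichromaticEdges⁻ yx∈))
    all≡ : ∀ {e e′} → e ∈ₗ B → e′ ∈ₗ B → e′ ≡ e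
    all≡ e∈ e′∈ with endpoints e∈ | endpoints e′∈
    ... | inj₁ refl | inj₁ refl = refl
    ... | inj₂ refl | inj₂ refl = refl
    ... | inj₁ refl | inj₂ refl = ⊥-elim (not-both e∈ e′∈)
    ... | inj₂ refl | inj₁ refl = ⊥-elim (not-both e∈ e′∈)
    length≡1 : ∀ {e} → e ∈ₗ B → length B ≡ 1
    length≡1 e∈ = unique⇒length≡1 bichromaticEdges-unique e∈ (all≡ e∈)

  sole-not : ∀ {c u v} → SoleBichromaticEdge c u v → SoleBichromaticEdge (not ∘ c) u v
  sole-not (uv , cu≢cv , sole) = uv , cu≢cv ∘ not-injective , λ xy ¬cx≢¬cy → sole xy (¬cx≢¬cy ∘ cong not)

parity : ∀ {n} → Permutation′ n → Fin n → Bool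
parity f w = odd (toℕ (f ⟨$⟩ʳ w))

module _ {n} (f : Permutation′ n) where

  negEdges≡#bichromatic : (G : Graph n) → negEdges G f ≡ #bichromatic G (parity f)
  negEdges≡#bichromatic G = cong length (filter-≐
    (λ e → T? (oppParity (suc (toℕ (f ⟨$⟩ʳ proj₁ e))) (suc (toℕ (f ⟨$⟩ʳ proj₂ e)))))
    (λ e → ¬? (parity f (proj₁ e) ≟ parity f (proj₂ e)))
    ((λ {e} → Equivalence.to (oppParity-suc⇔ (label (proj₁ e)) (label (proj₂ e)))) ,
     (λ {e} → Equivalence.from (oppParity-suc⇔ (label (proj₁ e)) (label (proj₂ e)))))
    (edges G))
    where
    label : Fin n → ℕ
    label w = toℕ (f ⟨$⟩ʳ w)

  balanced-parity : Balanced (count (parity f)) (count (not ∘ parity f))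
  balanced-parity = subst₂ Balanced
    (sym (trans (count-permute (odd ∘ toℕ) f) (count-odd n)))
    (sym (trans (count-permute (not ∘ odd ∘ toℕ) f) (count-even n)))
    (balanced-halves n)

parity-differs-on-first-labels : ∀ {n} (f : Permutation′ (suc (suc n))) →
                                 parity f (f ⟨$⟩ˡ zero) ≢ parity f (f ⟨$⟩ˡ suc zero)
parity-differs-on-first-labels f eq
  with () ← trans (cong (odd ∘ toℕ) (sym (inverseʳ f))) (trans eq (cong (odd ∘ toℕ) (inverseʳ f)))

-- A walk between the vertices labelled 1 and 2 must use a negative edge.
negEdges-positive : ∀ {n} {G : Graph n} → Connected G → ∀ {u v} → T (adj G u v) → ∀ f → 0 < negEdges G f
negEdges-positive {suc zero} {G} _ {zero} {zero} uu _ = ⊥-elim (subst T (irrefl G zero) uu)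
negEdges-positive {suc (suc n)} {G} connected _ f =
  let s , t , st , ps≢pt = reach-crossing (parity f) (connected (f ⟨$⟩ˡ zero) (f ⟨$⟩ˡ suc zero))
                                          (parity-differs-on-first-labels f)
  in subst (0 <_) (sym (negEdges≡#bichromatic f G)) (#bichromatic-positive G st ps≢pt)

parity-realises : ∀ {n} (c : Fin n → Bool) → count c ≡ ⌊ n /2⌋ ⊎ count c ≡ ⌈ n /2⌉ →
                  ∃ λ f → parity f ≗ c ⊎ not ∘ parity f ≗ c
parity-realises {n} c (inj₁ c≡⌊n/2⌋) with π , π≗ ← count≡⇒permutation c (odd ∘ toℕ) (trans c≡⌊n/2⌋ (sym (count-odd n)))
  = π , inj₁ π≗
parity-realises {n} c (inj₂ c≡⌈n/2⌉) with π , π≗ ← count≡⇒permutation c (not ∘ odd ∘ toℕ) (trans c≡⌈n/2⌉ (sym (count-even n)))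
  = π , inj₂ π≗

HasBalancedCutEdge : ∀ {n} → Graph n → Set
HasBalancedCutEdge {n} G = Σ (Fin n) λ u → Σ (Fin n) λ v → IsCutEdge G u v ×
  Σ ℕ λ a → Σ ℕ λ b →
    ComponentOrder (deleteEdge G u v) u a × ComponentOrder (deleteEdge G u v) v b × Balanced a b

module _ {n} {G : Graph n} (connected : Connected G) where

  sole⇒balancedCutEdge : ∀ {c u v} → SoleBichromaticEdge G c u v → c u ≡ true →
                         Balanced (count c) (count (not ∘ c)) → HasBalancedCutEdge G
  sole⇒balancedCutEdge {c} {u} {v} (uv , cu≢cv , sole) cu balanced =
    u , v , (uv , u↛v) , count c , count (not ∘ c) ,
    componentOrder-count reach-u⇔ , componentOrder-count reach-v⇔ , balanced
    where
    D : Graph n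
    D = deleteEdge G u v
    cv : c v ≡ false
    cv = trans (¬-not (cu≢cv ∘ sym)) (cong not cu)
    respects : ∀ {x y} → T (adj D x y) → c x ≡ c y
    respects {x} {y} xy = decidable-stable (c x ≟ c y) λ cx≢cy →
      Data.Sum.[ (λ { (refl , refl) → deleteEdge-removes G u v xy }) ,
                 (λ { (refl , refl) → deleteEdge-removes′ G u v xy }) ]
               (sole (adj-deleteEdge⊆ G u v xy) cx≢cy)
    u↛v : ¬ Reach D u v
    u↛v = cu≢cv ∘ reach-respects respects
    sides : ∀ w → Reach D u w ⊎ Reach D v w
    sides = deleteEdge-sides G u v connected
    reach-u⇔ : ∀ w → Reach D u w ⇔ c w ≡ true
    reach-u⇔ = colourClass⇔component respects sides cu cv
    reach-v⇔ : ∀ w → Reach D v w ⇔ not (c w) ≡ true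
    reach-v⇔ = colourClass⇔component (cong not ∘ respects) (Data.Sum.swap ∘ sides) (cong not cv) (cong not cu)

  sole⇒rna≡1 : ∀ {c u v} → SoleBichromaticEdge G c u v → Balanced (count c) (count (not ∘ c)) → RnaNumberIs G 1
  sole⇒rna≡1 {c} sole@(uv , _) balanced =
    let f , f≈c = parity-realises c (subst (λ k → count c ≡ ⌊ k /2⌋ ⊎ count c ≡ ⌈ k /2⌉)
                                           (count+count-not c) (balanced⇒half balanced))
    in (f , trans (negEdges≡#bichromatic f G) (trans (#bichromatic≡ {f} f≈c) (sole⇒#bichromatic≡1 G sole))) ,
       negEdges-positive connected uv
    where
    #bichromatic≡ : ∀ {f} → parity f ≗ c ⊎ not ∘ parity f ≗ c → #bichromatic G (parity f) ≡ #bichromatic G c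
    #bichromatic≡ (inj₁ f≗c)  = #bichromatic-≗ G f≗c
    #bichromatic≡ {f} (inj₂ ¬f≗c) = trans (sym (#bichromatic-not G (parity f))) (#bichromatic-≗ G ¬f≗c)

  rna≡1⇒balancedCutEdge : RnaNumberIs G 1 → HasBalancedCutEdge G
  rna≡1⇒balancedCutEdge ((f , negEdges≡1) , _)
    with u , v , sole ← #bichromatic≡1⇒sole G (trans (sym (negEdges≡#bichromatic f G)) negEdges≡1)
    with parity f u ≟ true
  ... | yes pu  = sole⇒balancedCutEdge sole pu (balanced-parity f)
  ... | no  ¬pu = sole⇒balancedCutEdge (sole-not G sole) (cong not (¬-not ¬pu))
                    (subst (Balanced _) (sym (count-cong (not-involutive ∘ parity f))) (swap (balanced-parity f)))

  balancedCutEdge⇒rna≡1 : HasBalancedCutEdge G → RnaNumberIs G 1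
  balancedCutEdge⇒rna≡1 (u , v , (uv , u↛v) , a , b , u-side@(S , S⇔ , _) , v-side , balanced) =
    sole⇒rna≡1 (uv , cu≢cv , sole) (subst₂ Balanced a≡ b≡ balanced)
    where
    D : Graph n
    D = deleteEdge G u v
    c : Fin n → Bool
    c = lookup S
    reach-u⇔ : ∀ w → Reach D u w ⇔ c w ≡ true
    reach-u⇔ w = ⇔.trans (⇔.sym (S⇔ w)) (∈⇔lookup S w)
    respects : ∀ {x y} → T (adj D x y) → c x ≡ c y
    respects = component-respects-adj reach-u⇔
    cu : c u ≡ true
    cu = Equivalence.to (reach-u⇔ u) here
    cv : c v ≡ false
    cv = ¬-not (u↛v ∘ Equivalence.from (reach-u⇔ v))
    cu≢cv : c u ≢ c v
    cu≢cv cu≡cv with () ← trans (sym cu) (trans cu≡cv cv)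
    sole : ∀ {x y} → T (adj G x y) → c x ≢ c y → (x ≡ u × y ≡ v) ⊎ (x ≡ v × y ≡ u)
    sole xy cx≢cy with adj-deleteEdge⁻ G u v xy
    ... | inj₁ uv      = inj₁ uv
    ... | inj₂ (inj₁ vu) = inj₂ vu
    ... | inj₂ (inj₂ xy′) = ⊥-elim (cx≢cy (respects xy′))
    reach-v⇔ : ∀ w → Reach D v w ⇔ not (c w) ≡ true
    reach-v⇔ = colourClass⇔component (cong not ∘ respects) (Data.Sum.swap ∘ deleteEdge-sides G u v connected)
                                     (cong not cv) (cong not cu)
    a≡ : a ≡ count c
    a≡ = componentOrder-unique u-side (componentOrder-count reach-u⇔)
    b≡ : b ≡ count (not ∘ c)
    b≡ = componentOrder-unique v-side (componentOrder-count reach-v⇔)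

theorem14 : (m : ℕ) → (G : Graph (suc m)) → Connected G →
    RnaNumberIs G 1 ⇔
      (Σ (Fin (suc m)) λ u → Σ (Fin (suc m)) λ v → IsCutEdge G u v ×
        Σ ℕ λ a → Σ ℕ λ b →
          ComponentOrder (deleteEdge G u v) u a ×
          ComponentOrder (deleteEdge G u v) v b ×
          a ≤ b + 1 × b ≤ a + 1)
theorem14 m G connected = mk⇔ (rna≡1⇒balancedCutEdge connected) (balancedCutEdge⇒rna≡1 connected)
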